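{- Let $\mathcal C\in\{\mathrm{ID},\mathrm{CD}\}$. The rules $(\wedge L)$, $(\wedge R)$, $(\vee L)$ and $(\vee R)$ are height-preserving invertible in $\mathsf{LBIQ}(\mathcal C)$: for every instance of one of these rules, if its conclusion has a proof of height $n$ in $\mathsf{LBIQ}(\mathcal C)$, then each of its premises has a proof of height at most $n$ in $\mathsf{LBIQ}(\mathcal C)$.
   Context: Syntax. Terms from variables and function symbols (constants have arity $0$); $\mathrm{Ter}(X)$ = terms with variables in $X$ (contains all constants), $\mathrm{Ter}=\mathrm{Ter}(\mathrm{Var})$, $\mathrm{VT}(t)$ variables of $t$, $\mathrm{VT}(\vec t)=\bigcup_i\mathrm{VT}(t_i)$. Formulae: $\varphi::=p(\vec t)\mid\bot\mid\top\mid\varphi\wedge\varphi\mid\varphi\vee\varphi\mid\varphi\mathbin{ -\!\!<}\varphi\mid\varphi\to\varphi\mid\exists x\varphi\mid\forall x\varphi$ ($\mathbin{ -\!\!<}$ exclusion); $\varphi(t/x)$ capture-avoiding substitution. Sequents. Labeled formula $w:\varphi$, relational atom $wRu$, domain atom $w:x$. A sequent is $\mathcal R,\mathcal T,\Gamma\vdash\Delta$ ($\mathcal R$ finite multiset of relational atoms, $\mathcal T$ of domain atoms, $\Gamma,\Delta$ of labeled formulae) with (1) if $\mathcal R\ne\emptyset$ every label in $\mathcal T,\Gamma,\Delta$ occurs in $\mathcal R$, and if $\mathcal R=\emptyset$ exactly one label occurs; (2) the directed graph of $\mathcal R$ connected without directed or undirected cycles. $w\twoheadrightarrow^*_{\mathcal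 R}u$ iff $w=u$ or there is a chain $wRv_1,\dots,v_nRu$ in $\mathcal R$. $X_w=\{x\mid u:x\in\mathcal T,\ u\twoheadrightarrow^*_{\mathcal R}w\}$; $t$ available for $w$ iff $t\in\mathrm{Ter}(X_w)$. Fresh = not occurring in the conclusion; side conditions evaluated in the conclusion. $\mathsf{LBIQ}(\mathrm{ID})$ (premises$\,/\,$conclusion, unchanged parts omitted): (ax) $\Gamma,w:p(\vec t)\vdash\Delta,u:p(\vec t)$ if $w\twoheadrightarrow^*_{\mathcal R}u$; $(\bot L)$ $\Gamma,w:\bot\vdash\Delta$; $(\top R)$ $\Gamma\vdash\Delta,w:\top$; $(\wedge L)$ $\Gamma,w:\varphi,w:\psi\vdash\Delta\,/\,\Gamma,w:\varphi\wedge\psi\vdash\Delta$; $(\wedge R)$ $\Gamma\vdash\Delta,w:\varphi$ and $\Gamma\vdash\Delta,w:\psi\,/\,\Gamma\vdash\Delta,w:\varphi\wedge\psi$; $(\vee L)$ $\Gamma,w:\varphi\vdash\Delta$ and $\Gamma,w:\psi\vdash\Delta\,/\,\Gamma,w:\varphi\vee\psi\vdash\Delta$; $(\vee R)$ $\Gamma\vdash\Delta,w:\varphi,w:\psi\,/\,\Gamma\vdash\Delta,w:\varphi\vee\psi$; $(\to L)$ $\Gamma,w:\varphi\to\psi\vdash\Delta,u:\varphi$ and $\Gamma,w:\varphi\to\psi,u:\psi\vdash\Delta\,/\,\Gamma,w:\varphi\to\psi\vdash\Delta$ if $w\twoheadrightarrow^*_{\mathcal R}u$; $(\to R)$ $\mathcal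 R,wRu,\mathcal T,\Gamma,u:\varphi\vdash\Delta,u:\psi\,/\,\mathcal R,\mathcal T,\Gamma\vdash\Delta,w:\varphi\to\psi$, $u$ fresh; $(\mathbin{ -\!\!<}L)$ $\mathcal R,uRw,\mathcal T,\Gamma,u:\varphi\vdash\Delta,u:\psi\,/\,\mathcal R,\mathcal T,\Gamma,w:\varphi\mathbin{ -\!\!<}\psi\vdash\Delta$, $u$ fresh; $(\mathbin{ -\!\!<}R)$ $\Gamma\vdash\Delta,u:\varphi\mathbin{ -\!\!<}\psi,w:\varphi$ and $\Gamma,w:\psi\vdash\Delta,u:\varphi\mathbin{ -\!\!<}\psi\,/\,\Gamma\vdash\Delta,u:\varphi\mathbin{ -\!\!<}\psi$ if $w\twoheadrightarrow^*_{\mathcal R}u$; $(\exists L)$ $\mathcal R,\mathcal T,w:y,\Gamma,w:\varphi(y/x)\vdash\Delta\,/\,\mathcal R,\mathcal T,\Gamma,w:\exists x\varphi\vdash\Delta$, $y$ fresh; $(\exists R)$ $\Gamma\vdash\Delta,w:\exists x\varphi,w:\varphi(t/x)\,/\,\Gamma\vdash\Delta,w:\exists x\varphi$ if $t$ available for $w$; $(\forall L)$ $\Gamma,w:\forall x\varphi,u:\varphi(t/x)\vdash\Delta\,/\,\Gamma,w:\forall x\varphi\vdash\Delta$ if $w\twoheadrightarrow^*_{\mathcal R}u$ and $t$ available for $u$; $(\forall R)$ $\mathcal R,wRu,\mathcal T,u:y,\Gamma\vdash\Delta,u:\varphi(y/x)\,/\,\mathcal R,\mathcal T,\Gamma\vdash\Delta,w:\forall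 x\varphi$, $u,y$ fresh; $(ds)$ $\mathcal R,\mathcal T,w:\mathrm{VT}(\vec t),\Gamma,w:p(\vec t)\vdash\Delta\,/\,\mathcal R,\mathcal T,\Gamma,w:p(\vec t)\vdash\Delta$. $\mathsf{LBIQ}(\mathrm{CD})$: remove $(ds)$, allow any $t\in\mathrm{Ter}$ in $(\exists R)$ and $(\forall L)$ (keeping $w\twoheadrightarrow^*_{\mathcal R}u$ in $(\forall L)$). Proofs are finite trees of rule instances with leaves (ax), $(\bot L)$, $(\top R)$; height = length of the longest branch. Sequents differing by a bijective label renaming are regarded as mutually derivable. -}

module Defs where

open import Data.Nat using (ℕ; _<_; _≤_; _⊔_; zero; suc; _≟_)
open import Data.Fin using (Fin)
open import Data.List using (List; []; _∷_; _++_; map; concatMap; length; lookup; deduplicate)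
open import Data.List.Membership.Propositional using (_∈_; _∉_)
open import Data.List.Relation.Unary.All using (All)
open import Data.List.Relation.Unary.Unique.Propositional using (Unique)
open import Data.List.Relation.Binary.Permutation.Propositional using (_↭_)
open import Data.Product using (Σ; _×_; _,_; proj₁; ∃)
open import Data.Sum using (_⊎_)
open import Data.Empty using (⊥)
open import Data.Unit using (⊤)
open import Relation.Binary.PropositionalEquality using (_≡_)
open import Relation.Nullary using (yes; no)

-- Syntax (locally nameless: free variables are named by ℕ, bound
-- variables are de Bruijn indices; function / predicate symbols are
-- named by ℕ and applied to a list of arguments).

data Term : Set where
  fvar : ℕ → Term
  bvar : ℕ → Term
  fn   : ℕ → List Term → Term

data Formula : Set where
  atom  : ℕ → List Term → Formula
  bot   : Formula
  top   : Formula
  _∧̇_   : Formula → Formula → Formula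
  _∨̇_   : Formula → Formula → Formula
  _−<_  : Formula → Formula → Formula
  _⇒_   : Formula → Formula → Formula
  Ex    : Formula → Formula              -- ∃ x φ (x = bound index 0)
  Fa    : Formula → Formula

infixr 6 _∧̇_
infixr 5 _∨̇_
infixr 4 _⇒_ _−<_

mutual
  instT : ℕ → Term → Term → Term
  instT k s (fvar x) = fvar x
  instT k s (bvar i) with i ≟ k
  ... | yes _ = s
  ... | no  _ = bvar i
  instT k s (fn f ts) = fn f (instTs k s ts)

  instTs : ℕ → Term → List Term → List Term
  instTs k s [] = []
  instTs k s (t ∷ ts) = instT k s t ∷ instTs k s ts

instF : ℕ → Term → Formula → Formula
instF k s (atom p ts) = atom p (instTs k s ts)
instF k s bot = bot
instF k s top = top
instF k s (φ ∧̇ ψ) = instF k s φ ∧̇ instF k s ψ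
instF k s (φ ∨̇ ψ) = instF k s φ ∨̇ instF k s ψ
instF k s (φ −< ψ) = instF k s φ −< instF k s ψ
instF k s (φ ⇒ ψ) = instF k s φ ⇒ instF k s ψ
instF k s (Ex φ) = Ex (instF (suc k) s φ)
instF k s (Fa φ) = Fa (instF (suc k) s φ)

_[_] : Formula → Term → Formula
φ [ t ] = instF 0 t φ

mutual
  fvT : Term → List ℕ
  fvT (fvar x) = x ∷ []
  fvT (bvar i) = []
  fvT (fn f ts) = fvTs ts

  fvTs : List Term → List ℕ
  fvTs [] = []
  fvTs (t ∷ ts) = fvT t ++ fvTs ts

fvF : Formula → List ℕ
fvF (atom p ts) = fvTs ts
fvF bot = []
fvF top = []
fvF (φ ∧̇ ψ) = fvF φ ++ fvF ψ
fvF (φ ∨̇ ψ) = fvF φ ++ fvF ψ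
fvF (φ −< ψ) = fvF φ ++ fvF ψ
fvF (φ ⇒ ψ) = fvF φ ++ fvF ψ
fvF (Ex φ) = fvF φ
fvF (Fa φ) = fvF φ

VT : List Term → List ℕ
VT ts = deduplicate _≟_ (fvTs ts)

-- local closedness: all bound indices are bound (< k binders)
mutual
  LCT : ℕ → Term → Set
  LCT k (fvar x) = ⊤
  LCT k (bvar i) = i < k
  LCT k (fn f ts) = LCTs k ts

  LCTs : ℕ → List Term → Set
  LCTs k [] = ⊤
  LCTs k (t ∷ ts) = LCT k t × LCTs k ts

LCF : ℕ → Formula → Set
LCF k (atom p ts) = LCTs k ts
LCF k bot = ⊤
LCF k top = ⊤
LCF k (φ ∧̇ ψ) = LCF k φ × LCF k ψ
LCF k (φ ∨̇ ψ) = LCF k φ × LCF k ψ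
LCF k (φ −< ψ) = LCF k φ × LCF k ψ
LCF k (φ ⇒ ψ) = LCF k φ × LCF k ψ
LCF k (Ex φ) = LCF (suc k) φ
LCF k (Fa φ) = LCF (suc k) φ

-- a genuine term (element of Ter): no dangling bound index
IsTerm : Term → Set
IsTerm = LCT 0

Label : Set
Label = ℕ

LF : Set
LF = Label × Formula

RelAtom : Set
RelAtom = Label × Label       -- (w , u) stands for wRu

DomAtom : Set
DomAtom = Label × ℕ           -- (w , x) stands for w : x

record Seq : Set where
  constructor ⟨_∣_∣_⊢_⟩
  field
    Rs : List RelAtom
    Ts : List DomAtom
    Γs : List LF
    Δs : List LF
open Seq public

-- equality of sequents as multisets (componentwise permutation)
_≈ₛ_ : Seq → Seq → Set
S ≈ₛ S' = (Rs S ↭ Rs S') × (Ts S ↭ Ts S') × (Γs S ↭ Γs S') × (Δs S ↭ Δs S')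

labelsR : List RelAtom → List Label
labelsR = concatMap (λ e → proj₁ e ∷ Data.Product.proj₂ e ∷ [])
  where import Data.Product

labelsTΓΔ : Seq → List Label
labelsTΓΔ S = map proj₁ (Ts S) ++ map proj₁ (Γs S) ++ map proj₁ (Δs S)

labelsS : Seq → List Label
labelsS S = labelsR (Rs S) ++ labelsTΓΔ S

varsS : Seq → List ℕ
varsS S = map Data.Product.proj₂ (Ts S) ++ concatMap (λ a → fvF (Data.Product.proj₂ a)) (Γs S)
          ++ concatMap (λ a → fvF (Data.Product.proj₂ a)) (Δs S)
  where import Data.Product

data Reach (R : List RelAtom) : Label → Label → Set where
  here : ∀ {w} → Reach R w w
  step : ∀ {w v u} → (w , v) ∈ R → Reach R v u → Reach R w u

InX : List RelAtom → List DomAtom → Label → ℕ → Set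
InX R T w x = Σ Label λ u → (u , x) ∈ T × Reach R u w

Available : List RelAtom → List DomAtom → Label → Term → Set
Available R T w t = IsTerm t × All (InX R T w) (fvT t)

Joins : RelAtom → Label → Label → Set
Joins (a , b) v v' = (a ≡ v × b ≡ v') ⊎ (a ≡ v' × b ≡ v)

data Walk (R : List RelAtom) : Label → Label → List (Fin (length R)) → Set where
  []  : ∀ {v} → Walk R v v []
  _∷_ : ∀ {v v' u is} (i : Fin (length R)) → Joins (lookup R i) v v' →
        Walk R v' u is → Walk R v u (i ∷ is)

Connected : List RelAtom → Set
Connected R = ∀ v u → v ∈ labelsR R → u ∈ labelsR R → Σ (List (Fin (length R))) (Walk R v u)

-- no (directed or undirected) cycle: no nonempty closed walk with
-- pairwise distinct edge occurrences (closed trail)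
Acyclic : List RelAtom → Set
Acyclic R = ∀ v i is → Walk R v v (i ∷ is) → Unique (i ∷ is) → ⊥

Cond1 : List RelAtom → List Label → Set
Cond1 [] ls = Σ Label λ w → w ∈ ls × All (_≡ w) ls
Cond1 (e ∷ R) ls = All (_∈ labelsR (e ∷ R)) ls

WF : Seq → Set
WF S = Cond1 (Rs S) (labelsTΓΔ S) × Connected (Rs S) × Acyclic (Rs S)
       × All (λ a → LCF 0 (Data.Product.proj₂ a)) (Γs S ++ Δs S)
  where import Data.Product

data Mode : Set where
  ID CD : Mode

Adm : Mode → List RelAtom → List DomAtom → Label → Term → Set
Adm ID R T w t = Available R T w t
Adm CD R T w t = IsTerm t

DsOK : Mode → Set
DsOK ID = ⊤
DsOK CD = ⊥

-- Proof C S : derivation trees. Each rule's conclusion is any sequent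
-- multiset-equal to the displayed pattern; side conditions are
-- evaluated in the (pattern of the) conclusion.
data Proof (C : Mode) (S : Seq) : Set where
  ax  : ∀ {R T Γ Δ w u p ts} → S ≈ₛ ⟨ R ∣ T ∣ (w , atom p ts) ∷ Γ ⊢ (u , atom p ts) ∷ Δ ⟩ →
        Reach R w u → Proof C S
  ⊥L  : ∀ {R T Γ Δ w} → S ≈ₛ ⟨ R ∣ T ∣ (w , bot) ∷ Γ ⊢ Δ ⟩ → Proof C S
  ⊤R  : ∀ {R T Γ Δ w} → S ≈ₛ ⟨ R ∣ T ∣ Γ ⊢ (w , top) ∷ Δ ⟩ → Proof C S
  ∧L  : ∀ {R T Γ Δ w φ ψ} → S ≈ₛ ⟨ R ∣ T ∣ (w , φ ∧̇ ψ) ∷ Γ ⊢ Δ ⟩ →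
        Proof C ⟨ R ∣ T ∣ (w , φ) ∷ (w , ψ) ∷ Γ ⊢ Δ ⟩ → Proof C S
  ∧R  : ∀ {R T Γ Δ w φ ψ} → S ≈ₛ ⟨ R ∣ T ∣ Γ ⊢ (w , φ ∧̇ ψ) ∷ Δ ⟩ →
        Proof C ⟨ R ∣ T ∣ Γ ⊢ (w , φ) ∷ Δ ⟩ → Proof C ⟨ R ∣ T ∣ Γ ⊢ (w , ψ) ∷ Δ ⟩ → Proof C S
  ∨L  : ∀ {R T Γ Δ w φ ψ} → S ≈ₛ ⟨ R ∣ T ∣ (w , φ ∨̇ ψ) ∷ Γ ⊢ Δ ⟩ →
        Proof C ⟨ R ∣ T ∣ (w , φ) ∷ Γ ⊢ Δ ⟩ → Proof C ⟨ R ∣ T ∣ (w , ψ) ∷ Γ ⊢ Δ ⟩ → Proof C S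
  ∨R  : ∀ {R T Γ Δ w φ ψ} → S ≈ₛ ⟨ R ∣ T ∣ Γ ⊢ (w , φ ∨̇ ψ) ∷ Δ ⟩ →
        Proof C ⟨ R ∣ T ∣ Γ ⊢ (w , φ) ∷ (w , ψ) ∷ Δ ⟩ → Proof C S
  ⇒L  : ∀ {R T Γ Δ w u φ ψ} → S ≈ₛ ⟨ R ∣ T ∣ (w , φ ⇒ ψ) ∷ Γ ⊢ Δ ⟩ → Reach R w u →
        Proof C ⟨ R ∣ T ∣ (w , φ ⇒ ψ) ∷ Γ ⊢ (u , φ) ∷ Δ ⟩ →
        Proof C ⟨ R ∣ T ∣ (u , ψ) ∷ (w , φ ⇒ ψ) ∷ Γ ⊢ Δ ⟩ → Proof C S
  ⇒R  : ∀ {R T Γ Δ w u φ ψ} → S ≈ₛ ⟨ R ∣ T ∣ Γ ⊢ (w , φ ⇒ ψ) ∷ Δ ⟩ →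
        u ∉ labelsS ⟨ R ∣ T ∣ Γ ⊢ (w , φ ⇒ ψ) ∷ Δ ⟩ →
        Proof C ⟨ (w , u) ∷ R ∣ T ∣ (u , φ) ∷ Γ ⊢ (u , ψ) ∷ Δ ⟩ → Proof C S
  −<L : ∀ {R T Γ Δ w u φ ψ} → S ≈ₛ ⟨ R ∣ T ∣ (w , φ −< ψ) ∷ Γ ⊢ Δ ⟩ →
        u ∉ labelsS ⟨ R ∣ T ∣ (w , φ −< ψ) ∷ Γ ⊢ Δ ⟩ →
        Proof C ⟨ (u , w) ∷ R ∣ T ∣ (u , φ) ∷ Γ ⊢ (u , ψ) ∷ Δ ⟩ → Proof C S
  −<R : ∀ {R T Γ Δ w u φ ψ} → S ≈ₛ ⟨ R ∣ T ∣ Γ ⊢ (u , φ −< ψ) ∷ Δ ⟩ → Reach R w u →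
        Proof C ⟨ R ∣ T ∣ Γ ⊢ (w , φ) ∷ (u , φ −< ψ) ∷ Δ ⟩ →
        Proof C ⟨ R ∣ T ∣ (w , ψ) ∷ Γ ⊢ (u , φ −< ψ) ∷ Δ ⟩ → Proof C S
  ∃L  : ∀ {R T Γ Δ w y φ} → S ≈ₛ ⟨ R ∣ T ∣ (w , Ex φ) ∷ Γ ⊢ Δ ⟩ →
        y ∉ varsS ⟨ R ∣ T ∣ (w , Ex φ) ∷ Γ ⊢ Δ ⟩ →
        Proof C ⟨ R ∣ (w , y) ∷ T ∣ (w , φ [ fvar y ]) ∷ Γ ⊢ Δ ⟩ → Proof C S
  ∃R  : ∀ {R T Γ Δ w φ t} → S ≈ₛ ⟨ R ∣ T ∣ Γ ⊢ (w , Ex φ) ∷ Δ ⟩ → Adm C R T w t →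
        Proof C ⟨ R ∣ T ∣ Γ ⊢ (w , φ [ t ]) ∷ (w , Ex φ) ∷ Δ ⟩ → Proof C S
  ∀L  : ∀ {R T Γ Δ w u φ t} → S ≈ₛ ⟨ R ∣ T ∣ (w , Fa φ) ∷ Γ ⊢ Δ ⟩ → Reach R w u →
        Adm C R T u t →
        Proof C ⟨ R ∣ T ∣ (u , φ [ t ]) ∷ (w , Fa φ) ∷ Γ ⊢ Δ ⟩ → Proof C S
  ∀R  : ∀ {R T Γ Δ w u y φ} → S ≈ₛ ⟨ R ∣ T ∣ Γ ⊢ (w , Fa φ) ∷ Δ ⟩ →
        u ∉ labelsS ⟨ R ∣ T ∣ Γ ⊢ (w , Fa φ) ∷ Δ ⟩ →
        y ∉ varsS ⟨ R ∣ T ∣ Γ ⊢ (w , Fa φ) ∷ Δ ⟩ →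
        Proof C ⟨ (w , u) ∷ R ∣ (u , y) ∷ T ∣ Γ ⊢ (u , φ [ fvar y ]) ∷ Δ ⟩ → Proof C S
  ds  : ∀ {R T Γ Δ w p ts} → DsOK C → S ≈ₛ ⟨ R ∣ T ∣ (w , atom p ts) ∷ Γ ⊢ Δ ⟩ →
        Proof C ⟨ R ∣ map (w ,_) (VT ts) ++ T ∣ (w , atom p ts) ∷ Γ ⊢ Δ ⟩ → Proof C S

height : ∀ {C S} → Proof C S → ℕ
height (ax _ _) = 0
height (⊥L _) = 0
height (⊤R _) = 0
height (∧L _ p) = suc (height p)
height (∧R _ p q) = suc (height p ⊔ height q)
height (∨L _ p q) = suc (height p ⊔ height q)
height (∨R _ p) = suc (height p)
height (⇒L _ _ p q) = suc (height p ⊔ height q)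
height (⇒R _ _ p) = suc (height p)
height (−<L _ _ p) = suc (height p)
height (−<R _ _ p q) = suc (height p ⊔ height q)
height (∃L _ _ p) = suc (height p)
height (∃R _ _ p) = suc (height p)
height (∀L _ _ _ p) = suc (height p)
height (∀R _ _ _ p) = suc (height p)
height (ds _ _ p) = suc (height p)

HPInv : Mode → Seq → Seq → Set
HPInv C concl prem = (π : Proof C concl) → Σ (Proof C prem) λ π' → height π' ≤ height π

-- If its last rule has the inverted formula as
-- principal formula, its premise is the required sequent up to multiset
-- equality. Otherwise that formula lies in the context of the rule: invert it
-- in the premises and reapply the rule. The side conditions survive: those on
-- reachability and availability only concern R and T, which are untouched, and
-- freshness is kept because the components of φ ∧ ψ and φ ∨ ψ carry no labels or
-- variables beyond theirs.

module Submission where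

open import Defs
open import Data.Nat using (ℕ; suc; _≤_; _⊔_; s≤s; z≤n)
open import Data.Nat.Properties
  using (≤-refl; ≤-trans; ≤-reflexive; ⊔-mono-≤; m≤m⊔n; m≤n⊔m; n≤1+n; m≤n⇒m≤1+n)
open import Data.List using (List; []; _∷_; _++_; map; concatMap)
open import Data.List.Membership.Propositional using (_∈_; _∉_; find; lose)
open import Data.List.Membership.Propositional.Properties
  using (∈-++⁻; ∈-map⁻; ∈-map⁺; ∈-concatMap⁻; ∈-concatMap⁺; ∈-∃++)
open import Data.List.Relation.Unary.All using (All; []; _∷_; lookup)
open import Data.List.Relation.Unary.Any using (here; there)
open import Data.List.Relation.Binary.Subset.Propositional using (_⊆_)
open import Data.List.Relation.Binary.Subset.Propositional.Properties
  using (⊆-refl; xs⊆xs++ys; xs⊆ys++xs)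
  renaming (++⁺ to ⊆-++⁺; ++⁺ʳ to ⊆-++⁺ʳ)
open import Data.List.Relation.Binary.Permutation.Propositional
  using (_↭_; ↭-refl; ↭-sym; ↭-trans; prep; swap)
open import Data.List.Relation.Binary.Permutation.Propositional.Properties
  using (∈-resp-↭; drop-∷; shift; shifts; ++⁺ˡ)
open import Data.Product using (∃-syntax; _×_; _,_; proj₁; proj₂)
open import Data.Sum using (inj₁; inj₂)
open import Function using (_∘_)
open import Relation.Binary.PropositionalEquality using (_≡_; refl; sym; subst)

≈ₛ-sym : ∀ {S S'} → S ≈ₛ S' → S' ≈ₛ S
≈ₛ-sym (eR , eT , eΓ , eΔ) = ↭-sym eR , ↭-sym eT , ↭-sym eΓ , ↭-sym eΔ

≈ₛ-trans : ∀ {S S' S''} → S ≈ₛ S' → S' ≈ₛ S'' → S ≈ₛ S''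
≈ₛ-trans (eR , eT , eΓ , eΔ) (eR' , eT' , eΓ' , eΔ') =
  ↭-trans eR eR' , ↭-trans eT eT' , ↭-trans eΓ eΓ' , ↭-trans eΔ eΔ'

Proof≤ : Mode → Seq → ℕ → Set
Proof≤ C S n = ∃[ π ] height {C} {S} π ≤ n

exact : ∀ {C S} (π : Proof C S) → Proof≤ C S (height π)
exact π = π , ≤-refl

weaken : ∀ {C S m n} → m ≤ n → Proof≤ C S m → Proof≤ C S n
weaken m≤n (π , h) = π , ≤-trans h m≤n

resp-≈ₛ : ∀ {C S S' n} → S ≈ₛ S' → Proof≤ C S n → Proof≤ C S' n
resp-≈ₛ {C} {S} {S'} e (π , h) = retarget π , ≤-trans (≤-reflexive (height-retarget π)) h
  where
  e⁻¹ = ≈ₛ-sym e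
  retarget : Proof C S → Proof C S'
  retarget (ax q r)          = ax (≈ₛ-trans e⁻¹ q) r
  retarget (⊥L q)            = ⊥L (≈ₛ-trans e⁻¹ q)
  retarget (⊤R q)            = ⊤R (≈ₛ-trans e⁻¹ q)
  retarget (∧L q p)          = ∧L (≈ₛ-trans e⁻¹ q) p
  retarget (∧R q p p')       = ∧R (≈ₛ-trans e⁻¹ q) p p'
  retarget (∨L q p p')       = ∨L (≈ₛ-trans e⁻¹ q) p p'
  retarget (∨R q p)          = ∨R (≈ₛ-trans e⁻¹ q) p
  retarget (⇒L q r p p')     = ⇒L (≈ₛ-trans e⁻¹ q) r p p'
  retarget (⇒R q r p)        = ⇒R (≈ₛ-trans e⁻¹ q) r p
  retarget (−<L q r p)       = −<L (≈ₛ-trans e⁻¹ q) r p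
  retarget (−<R q r p p')    = −<R (≈ₛ-trans e⁻¹ q) r p p'
  retarget (∃L q r p)        = ∃L (≈ₛ-trans e⁻¹ q) r p
  retarget (∃R q r p)        = ∃R (≈ₛ-trans e⁻¹ q) r p
  retarget (∀L q r r' p)     = ∀L (≈ₛ-trans e⁻¹ q) r r' p
  retarget (∀R q r r' p)     = ∀R (≈ₛ-trans e⁻¹ q) r r' p
  retarget (ds d q p)        = ds d (≈ₛ-trans e⁻¹ q) p
  height-retarget : (π : Proof C S) → height (retarget π) ≡ height π
  height-retarget (ax _ _)       = refl
  height-retarget (⊥L _)         = refl
  height-retarget (⊤R _)         = refl
  height-retarget (∧L _ _)       = refl
  height-retarget (∧R _ _ _)     = refl
  height-retarget (∨L _ _ _)     = refl
  height-retarget (∨R _ _)       = refl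
  height-retarget (⇒L _ _ _ _)   = refl
  height-retarget (⇒R _ _ _)     = refl
  height-retarget (−<L _ _ _)    = refl
  height-retarget (−<R _ _ _ _)  = refl
  height-retarget (∃L _ _ _)     = refl
  height-retarget (∃R _ _ _)     = refl
  height-retarget (∀L _ _ _ _)   = refl
  height-retarget (∀R _ _ _ _)   = refl
  height-retarget (ds _ _ _)     = refl

rule₁ : ∀ {C P S n} (r : Proof C P → Proof C S) → (∀ π → height (r π) ≡ suc (height π)) →
  Proof≤ C P n → Proof≤ C S (suc n)
rule₁ {n = n} r h-r (π , h) = r π , subst (_≤ suc n) (sym (h-r π)) (s≤s h)

rule₂ : ∀ {C P Q S m n} (r : Proof C P → Proof C Q → Proof C S) →
  (∀ π ρ → height (r π ρ) ≡ suc (height π ⊔ height ρ)) →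
  Proof≤ C P m → Proof≤ C Q n → Proof≤ C S (suc (m ⊔ n))
rule₂ {m = m} {n} r h-r (π , h) (ρ , k) =
  r π ρ , subst (_≤ suc (m ⊔ n)) (sym (h-r π ρ)) (s≤s (⊔-mono-≤ h k))

module _ {A : Set} where

  prefix-↭-∷ : ∀ (zs : List A) {x xs ys} → xs ↭ x ∷ ys → zs ++ xs ↭ x ∷ zs ++ ys
  prefix-↭-∷ zs {x} {ys = ys} p = ↭-trans (++⁺ˡ zs p) (shift x zs ys)

  data Heads (x : A) (xs : List A) : A → List A → Set where
    same  : ∀ {ys} → xs ↭ ys → Heads x xs x ys
    apart : ∀ {y ys} zs → ys ↭ x ∷ zs → xs ↭ y ∷ zs → Heads x xs y ys

  heads-↭ : ∀ {x y : A} {xs ys} → x ∷ xs ↭ y ∷ ys → Heads x xs y ys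
  heads-↭ {x} {y} p with ∈-resp-↭ p (here refl)
  ... | here refl = same (drop-∷ p)
  ... | there x∈ys with us , vs , refl ← ∈-∃++ x∈ys =
    apart (us ++ vs) ys↭ (drop-∷ (↭-trans p (↭-trans (prep y ys↭) (swap y x ↭-refl))))
    where ys↭ = shift x us vs

  heads : ∀ {x y : A} {zs xs ys} → zs ↭ x ∷ xs → zs ↭ y ∷ ys → Heads x xs y ys
  heads σ τ = heads-↭ (↭-trans (↭-sym σ) τ)

infix 4 _⊑_ _⊑*_

_⊑_ : LF → LF → Set
a ⊑ b = proj₁ a ≡ proj₁ b × fvF (proj₂ a) ⊆ fvF (proj₂ b)

_⊑*_ : List LF → List LF → Set
Γ ⊑* Γ' = ∀ {a} → a ∈ Γ → ∃[ b ] b ∈ Γ' × a ⊑ b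

⊑*-refl : ∀ {Γ} → Γ ⊑* Γ
⊑*-refl a∈ = _ , a∈ , refl , ⊆-refl

⊑*-∷ : ∀ b {Γ Γ'} → Γ ⊑* Γ' → b ∷ Γ ⊑* b ∷ Γ'
⊑*-∷ _ s (here refl) = _ , here refl , refl , ⊆-refl
⊑*-∷ _ s (there a∈) with b , b∈ , a⊑b ← s a∈ = b , there b∈ , a⊑b

⊑*-replace : ∀ {A L Γ Γ'} → All (_⊑ A) L → Γ ↭ A ∷ Γ' → L ++ Γ' ⊑* Γ
⊑*-replace {L = L} L⊑A p a∈ with ∈-++⁻ L a∈
... | inj₁ a∈L = _ , ∈-resp-↭ (↭-sym p) (here refl) , lookup L⊑A a∈L
... | inj₂ a∈Γ' = _ , ∈-resp-↭ (↭-sym p) (there a∈Γ') , refl , ⊆-refl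

labels-mono : ∀ {Γ Γ'} → Γ ⊑* Γ' → map proj₁ Γ ⊆ map proj₁ Γ'
labels-mono s x∈ with a , a∈ , refl ← ∈-map⁻ proj₁ x∈ with b , b∈ , label≡ , _ ← s a∈ =
  subst (_∈ _) (sym label≡) (∈-map⁺ proj₁ b∈)

vars-mono : ∀ {Γ Γ'} → Γ ⊑* Γ' → concatMap (fvF ∘ proj₂) Γ ⊆ concatMap (fvF ∘ proj₂) Γ'
vars-mono s x∈ with a , a∈ , x∈a ← find (∈-concatMap⁻ _ x∈) with b , b∈ , _ , fv⊆ ← s a∈ =
  ∈-concatMap⁺ _ (lose b∈ (fv⊆ x∈a))

fresh-label : ∀ R T {Γ Γ' Δ Δ' u} → Γ ⊑* Γ' → Δ ⊑* Δ' →
  u ∉ labelsS ⟨ R ∣ T ∣ Γ' ⊢ Δ' ⟩ → u ∉ labelsS ⟨ R ∣ T ∣ Γ ⊢ Δ ⟩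
fresh-label R T sΓ sΔ u∉ =
  u∉ ∘ ⊆-++⁺ʳ (labelsR R) (⊆-++⁺ʳ (map proj₁ T) (⊆-++⁺ (labels-mono sΓ) (labels-mono sΔ)))

fresh-var : ∀ R T {Γ Γ' Δ Δ' y} → Γ ⊑* Γ' → Δ ⊑* Δ' →
  y ∉ varsS ⟨ R ∣ T ∣ Γ' ⊢ Δ' ⟩ → y ∉ varsS ⟨ R ∣ T ∣ Γ ⊢ Δ ⟩
fresh-var _ T sΓ sΔ y∉ = y∉ ∘ ⊆-++⁺ʳ (map proj₂ T) (⊆-++⁺ (vars-mono sΓ) (vars-mono sΔ))

data InvertibleL : LF → List LF → Set where
  ∧L⁻  : ∀ {w φ ψ} → InvertibleL (w , φ ∧̇ ψ) ((w , φ) ∷ (w , ψ) ∷ [])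
  ∨L⁻₁ : ∀ {w φ ψ} → InvertibleL (w , φ ∨̇ ψ) ((w , φ) ∷ [])
  ∨L⁻₂ : ∀ {w φ ψ} → InvertibleL (w , φ ∨̇ ψ) ((w , ψ) ∷ [])

InvertibleL-⊑* : ∀ {A L Γ Γ'} → InvertibleL A L → Γ ↭ A ∷ Γ' → L ++ Γ' ⊑* Γ
InvertibleL-⊑* ∧L⁻            = ⊑*-replace ((refl , xs⊆xs++ys _ _) ∷ (refl , xs⊆ys++xs _ _) ∷ [])
InvertibleL-⊑* ∨L⁻₁           = ⊑*-replace ((refl , xs⊆xs++ys _ _) ∷ [])
InvertibleL-⊑* (∨L⁻₂ {φ = φ}) = ⊑*-replace ((refl , xs⊆ys++xs _ (fvF φ)) ∷ [])

principalL : ∀ {S R T B Γ Γ' Δ} (L : List LF) → S ≈ₛ ⟨ R ∣ T ∣ B ∷ Γ ⊢ Δ ⟩ → Γ' ↭ Γ →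
  ⟨ R ∣ T ∣ L ++ Γ ⊢ Δ ⟩ ≈ₛ ⟨ Rs S ∣ Ts S ∣ L ++ Γ' ⊢ Δs S ⟩
principalL L (eR , eT , _ , eΔ) σ = ↭-sym eR , ↭-sym eT , ++⁺ˡ L (↭-sym σ) , ↭-sym eΔ

invertL : ∀ {C A L} → InvertibleL A L → ∀ {S Γ} → Γs S ↭ A ∷ Γ → (π : Proof C S) →
  Proof≤ C ⟨ Rs S ∣ Ts S ∣ L ++ Γ ⊢ Δs S ⟩ (height π)

invertL-under : ∀ {C A L} → InvertibleL A L → ∀ {R T Γ Γ' Δ} (X : List LF) → Γ ↭ A ∷ Γ' →
  (π : Proof C ⟨ R ∣ T ∣ X ++ Γ ⊢ Δ ⟩) → Proof≤ C ⟨ R ∣ T ∣ X ++ L ++ Γ' ⊢ Δ ⟩ (height π)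
invertL-under {L = L} inv X σ π =
  resp-≈ₛ (↭-refl , ↭-refl , shifts L X , ↭-refl) (invertL inv (prefix-↭-∷ X σ) π)

invertL inv σ (ax (eR , eT , eΓ , eΔ) r) with heads σ eΓ
invertL () σ (ax _ _) | same _
... | apart _ _ σ₂ = ax (eR , eT , prefix-↭-∷ _ σ₂ , eΔ) r , z≤n
invertL inv σ (⊥L (eR , eT , eΓ , eΔ)) with heads σ eΓ
invertL () σ (⊥L _) | same _
... | apart _ _ σ₂ = ⊥L (eR , eT , prefix-↭-∷ _ σ₂ , eΔ) , z≤n
invertL inv σ (⊤R (eR , eT , eΓ , eΔ)) = ⊤R (eR , eT , ↭-refl , eΔ) , z≤n
invertL inv σ (∧L {w = w} {φ} {ψ} (eR , eT , eΓ , eΔ) p) with heads σ eΓ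
invertL ∧L⁻ σ (∧L e p) | same σ₀ = weaken (n≤1+n _) (resp-≈ₛ (principalL _ e σ₀) (exact p))
... | apart _ σ₁ σ₂ =
  rule₁ (∧L (eR , eT , prefix-↭-∷ _ σ₂ , eΔ)) (λ _ → refl)
    (invertL-under inv ((w , φ) ∷ (w , ψ) ∷ []) σ₁ p)
invertL inv σ (∧R (eR , eT , eΓ , eΔ) p q) =
  let σ' = ↭-trans (↭-sym eΓ) σ in
  rule₂ (∧R (eR , eT , ↭-refl , eΔ)) (λ _ _ → refl) (invertL inv σ' p) (invertL inv σ' q)
invertL inv σ (∨L {w = w} {φ} {ψ} (eR , eT , eΓ , eΔ) p q) with heads σ eΓ
invertL ∨L⁻₁ σ (∨L e p q) | same σ₀ =
  weaken (m≤n⇒m≤1+n (m≤m⊔n _ _)) (resp-≈ₛ (principalL _ e σ₀) (exact p))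
invertL ∨L⁻₂ σ (∨L e p q) | same σ₀ =
  weaken (m≤n⇒m≤1+n (m≤n⊔m _ _)) (resp-≈ₛ (principalL _ e σ₀) (exact q))
... | apart _ σ₁ σ₂ =
  rule₂ (∨L (eR , eT , prefix-↭-∷ _ σ₂ , eΔ)) (λ _ _ → refl)
    (invertL-under inv ((w , φ) ∷ []) σ₁ p) (invertL-under inv ((w , ψ) ∷ []) σ₁ q)
invertL inv σ (∨R (eR , eT , eΓ , eΔ) p) =
  rule₁ (∨R (eR , eT , ↭-refl , eΔ)) (λ _ → refl) (invertL inv (↭-trans (↭-sym eΓ) σ) p)
invertL inv σ (⇒L {w = w} {u} {φ} {ψ} (eR , eT , eΓ , eΔ) r p q) with heads σ eΓ
invertL () σ (⇒L _ _ _ _) | same _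
... | apart _ σ₁ σ₂ =
  rule₂ (⇒L (eR , eT , prefix-↭-∷ _ σ₂ , eΔ) r) (λ _ _ → refl)
    (invertL-under inv ((w , φ ⇒ ψ) ∷ []) σ₁ p)
    (invertL-under inv ((u , ψ) ∷ (w , φ ⇒ ψ) ∷ []) σ₁ q)
invertL inv σ (⇒R {R} {T} {Δ = Δ} {w} {u} {φ} {ψ} (eR , eT , eΓ , eΔ) u∉ p) =
  let σ' = ↭-trans (↭-sym eΓ) σ in
  rule₁ (⇒R (eR , eT , ↭-refl , eΔ)
            (fresh-label R T (InvertibleL-⊑* inv σ') (⊑*-refl {(w , φ ⇒ ψ) ∷ Δ}) u∉))
    (λ _ → refl) (invertL-under inv ((u , φ) ∷ []) σ' p)
invertL inv σ (−<L {R} {T} {Δ = Δ} {w} {u} {φ} {ψ} (eR , eT , eΓ , eΔ) u∉ p) with heads σ eΓ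
invertL () σ (−<L _ _ _) | same _
... | apart _ σ₁ σ₂ =
  rule₁ (−<L (eR , eT , prefix-↭-∷ _ σ₂ , eΔ)
             (fresh-label R T (⊑*-∷ (w , φ −< ψ) (InvertibleL-⊑* inv σ₁)) (⊑*-refl {Δ}) u∉))
    (λ _ → refl) (invertL-under inv ((u , φ) ∷ []) σ₁ p)
invertL inv σ (−<R {w = w} {ψ = ψ} (eR , eT , eΓ , eΔ) r p q) =
  let σ' = ↭-trans (↭-sym eΓ) σ in
  rule₂ (−<R (eR , eT , ↭-refl , eΔ) r) (λ _ _ → refl)
    (invertL inv σ' p) (invertL-under inv ((w , ψ) ∷ []) σ' q)
invertL inv σ (∃L {R} {T} {Δ = Δ} {w} {y} {φ} (eR , eT , eΓ , eΔ) y∉ p) with heads σ eΓ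
invertL () σ (∃L _ _ _) | same _
... | apart _ σ₁ σ₂ =
  rule₁ (∃L (eR , eT , prefix-↭-∷ _ σ₂ , eΔ)
            (fresh-var R T (⊑*-∷ (w , Ex φ) (InvertibleL-⊑* inv σ₁)) (⊑*-refl {Δ}) y∉))
    (λ _ → refl) (invertL-under inv ((w , φ [ fvar y ]) ∷ []) σ₁ p)
invertL inv σ (∃R (eR , eT , eΓ , eΔ) t-ok p) =
  rule₁ (∃R (eR , eT , ↭-refl , eΔ) t-ok) (λ _ → refl) (invertL inv (↭-trans (↭-sym eΓ) σ) p)
invertL inv σ (∀L {w = w} {u} {φ} {t} (eR , eT , eΓ , eΔ) r t-ok p) with heads σ eΓ
invertL () σ (∀L _ _ _ _) | same _
... | apart _ σ₁ σ₂ =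
  rule₁ (∀L (eR , eT , prefix-↭-∷ _ σ₂ , eΔ) r t-ok) (λ _ → refl)
    (invertL-under inv ((u , φ [ t ]) ∷ (w , Fa φ) ∷ []) σ₁ p)
invertL inv σ (∀R {R} {T} {Δ = Δ} {w} {φ = φ} (eR , eT , eΓ , eΔ) u∉ y∉ p) =
  let σ' = ↭-trans (↭-sym eΓ) σ
      ⊑Γ = InvertibleL-⊑* inv σ'
  in
  rule₁ (∀R (eR , eT , ↭-refl , eΔ)
            (fresh-label R T ⊑Γ (⊑*-refl {(w , Fa φ) ∷ Δ}) u∉)
            (fresh-var R T ⊑Γ (⊑*-refl {(w , Fa φ) ∷ Δ}) y∉))
    (λ _ → refl) (invertL inv σ' p)
invertL inv σ (ds {w = w} {p} {ts} d (eR , eT , eΓ , eΔ) π) with heads σ eΓ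
invertL () σ (ds _ _ _) | same _
... | apart _ σ₁ σ₂ =
  rule₁ (ds d (eR , eT , prefix-↭-∷ _ σ₂ , eΔ)) (λ _ → refl)
    (invertL-under inv ((w , atom p ts) ∷ []) σ₁ π)

data InvertibleR : LF → List LF → Set where
  ∧R⁻₁ : ∀ {w φ ψ} → InvertibleR (w , φ ∧̇ ψ) ((w , φ) ∷ [])
  ∧R⁻₂ : ∀ {w φ ψ} → InvertibleR (w , φ ∧̇ ψ) ((w , ψ) ∷ [])
  ∨R⁻  : ∀ {w φ ψ} → InvertibleR (w , φ ∨̇ ψ) ((w , φ) ∷ (w , ψ) ∷ [])

InvertibleR-⊑* : ∀ {A L Δ Δ'} → InvertibleR A L → Δ ↭ A ∷ Δ' → L ++ Δ' ⊑* Δ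
InvertibleR-⊑* ∧R⁻₁           = ⊑*-replace ((refl , xs⊆xs++ys _ _) ∷ [])
InvertibleR-⊑* (∧R⁻₂ {φ = φ}) = ⊑*-replace ((refl , xs⊆ys++xs _ (fvF φ)) ∷ [])
InvertibleR-⊑* ∨R⁻            = ⊑*-replace ((refl , xs⊆xs++ys _ _) ∷ (refl , xs⊆ys++xs _ _) ∷ [])

principalR : ∀ {S R T B Γ Δ Δ'} (L : List LF) → S ≈ₛ ⟨ R ∣ T ∣ Γ ⊢ B ∷ Δ ⟩ → Δ' ↭ Δ →
  ⟨ R ∣ T ∣ Γ ⊢ L ++ Δ ⟩ ≈ₛ ⟨ Rs S ∣ Ts S ∣ Γs S ⊢ L ++ Δ' ⟩
principalR L (eR , eT , eΓ , _) σ = ↭-sym eR , ↭-sym eT , ↭-sym eΓ , ++⁺ˡ L (↭-sym σ)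

invertR : ∀ {C A L} → InvertibleR A L → ∀ {S Δ} → Δs S ↭ A ∷ Δ → (π : Proof C S) →
  Proof≤ C ⟨ Rs S ∣ Ts S ∣ Γs S ⊢ L ++ Δ ⟩ (height π)

invertR-under : ∀ {C A L} → InvertibleR A L → ∀ {R T Γ Δ Δ'} (X : List LF) → Δ ↭ A ∷ Δ' →
  (π : Proof C ⟨ R ∣ T ∣ Γ ⊢ X ++ Δ ⟩) → Proof≤ C ⟨ R ∣ T ∣ Γ ⊢ X ++ L ++ Δ' ⟩ (height π)
invertR-under {L = L} inv X σ π =
  resp-≈ₛ (↭-refl , ↭-refl , ↭-refl , shifts L X) (invertR inv (prefix-↭-∷ X σ) π)

invertR inv σ (ax (eR , eT , eΓ , eΔ) r) with heads σ eΔ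
invertR () σ (ax _ _) | same _
... | apart _ _ σ₂ = ax (eR , eT , eΓ , prefix-↭-∷ _ σ₂) r , z≤n
invertR inv σ (⊥L (eR , eT , eΓ , eΔ)) = ⊥L (eR , eT , eΓ , ↭-refl) , z≤n
invertR inv σ (⊤R (eR , eT , eΓ , eΔ)) with heads σ eΔ
invertR () σ (⊤R _) | same _
... | apart _ _ σ₂ = ⊤R (eR , eT , eΓ , prefix-↭-∷ _ σ₂) , z≤n
invertR inv σ (∧L (eR , eT , eΓ , eΔ) p) =
  rule₁ (∧L (eR , eT , eΓ , ↭-refl)) (λ _ → refl) (invertR inv (↭-trans (↭-sym eΔ) σ) p)
invertR inv σ (∧R {w = w} {φ} {ψ} (eR , eT , eΓ , eΔ) p q) with heads σ eΔ
invertR ∧R⁻₁ σ (∧R e p q) | same σ₀ =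
  weaken (m≤n⇒m≤1+n (m≤m⊔n _ _)) (resp-≈ₛ (principalR _ e σ₀) (exact p))
invertR ∧R⁻₂ σ (∧R e p q) | same σ₀ =
  weaken (m≤n⇒m≤1+n (m≤n⊔m _ _)) (resp-≈ₛ (principalR _ e σ₀) (exact q))
... | apart _ σ₁ σ₂ =
  rule₂ (∧R (eR , eT , eΓ , prefix-↭-∷ _ σ₂)) (λ _ _ → refl)
    (invertR-under inv ((w , φ) ∷ []) σ₁ p) (invertR-under inv ((w , ψ) ∷ []) σ₁ q)
invertR inv σ (∨L (eR , eT , eΓ , eΔ) p q) =
  let σ' = ↭-trans (↭-sym eΔ) σ in
  rule₂ (∨L (eR , eT , eΓ , ↭-refl)) (λ _ _ → refl) (invertR inv σ' p) (invertR inv σ' q)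
invertR inv σ (∨R {w = w} {φ} {ψ} (eR , eT , eΓ , eΔ) p) with heads σ eΔ
invertR ∨R⁻ σ (∨R e p) | same σ₀ = weaken (n≤1+n _) (resp-≈ₛ (principalR _ e σ₀) (exact p))
... | apart _ σ₁ σ₂ =
  rule₁ (∨R (eR , eT , eΓ , prefix-↭-∷ _ σ₂)) (λ _ → refl)
    (invertR-under inv ((w , φ) ∷ (w , ψ) ∷ []) σ₁ p)
invertR inv σ (⇒L {u = u} {φ} (eR , eT , eΓ , eΔ) r p q) =
  let σ' = ↭-trans (↭-sym eΔ) σ in
  rule₂ (⇒L (eR , eT , eΓ , ↭-refl) r) (λ _ _ → refl)
    (invertR-under inv ((u , φ) ∷ []) σ' p) (invertR inv σ' q)
invertR inv σ (⇒R {R} {T} {Γ} {w = w} {u} {φ} {ψ} (eR , eT , eΓ , eΔ) u∉ p)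
  with heads σ eΔ
invertR () σ (⇒R _ _ _) | same _
... | apart _ σ₁ σ₂ =
  rule₁ (⇒R (eR , eT , eΓ , prefix-↭-∷ _ σ₂)
            (fresh-label R T (⊑*-refl {Γ}) (⊑*-∷ (w , φ ⇒ ψ) (InvertibleR-⊑* inv σ₁)) u∉))
    (λ _ → refl) (invertR-under inv ((u , ψ) ∷ []) σ₁ p)
invertR inv σ (−<L {R} {T} {Γ} {w = w} {u} {φ} {ψ} (eR , eT , eΓ , eΔ) u∉ p) =
  let σ' = ↭-trans (↭-sym eΔ) σ in
  rule₁ (−<L (eR , eT , eΓ , ↭-refl)
             (fresh-label R T (⊑*-refl {(w , φ −< ψ) ∷ Γ}) (InvertibleR-⊑* inv σ') u∉))
    (λ _ → refl) (invertR-under inv ((u , ψ) ∷ []) σ' p)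
invertR inv σ (−<R {w = w} {u} {φ} {ψ} (eR , eT , eΓ , eΔ) r p q) with heads σ eΔ
invertR () σ (−<R _ _ _ _) | same _
... | apart _ σ₁ σ₂ =
  rule₂ (−<R (eR , eT , eΓ , prefix-↭-∷ _ σ₂) r) (λ _ _ → refl)
    (invertR-under inv ((w , φ) ∷ (u , φ −< ψ) ∷ []) σ₁ p)
    (invertR-under inv ((u , φ −< ψ) ∷ []) σ₁ q)
invertR inv σ (∃L {R} {T} {Γ} {w = w} {φ = φ} (eR , eT , eΓ , eΔ) y∉ p) =
  let σ' = ↭-trans (↭-sym eΔ) σ in
  rule₁ (∃L (eR , eT , eΓ , ↭-refl)
            (fresh-var R T (⊑*-refl {(w , Ex φ) ∷ Γ}) (InvertibleR-⊑* inv σ') y∉))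
    (λ _ → refl) (invertR inv σ' p)
invertR inv σ (∃R {w = w} {φ} {t} (eR , eT , eΓ , eΔ) t-ok p) with heads σ eΔ
invertR () σ (∃R _ _ _) | same _
... | apart _ σ₁ σ₂ =
  rule₁ (∃R (eR , eT , eΓ , prefix-↭-∷ _ σ₂) t-ok) (λ _ → refl)
    (invertR-under inv ((w , φ [ t ]) ∷ (w , Ex φ) ∷ []) σ₁ p)
invertR inv σ (∀L (eR , eT , eΓ , eΔ) r t-ok p) =
  rule₁ (∀L (eR , eT , eΓ , ↭-refl) r t-ok) (λ _ → refl) (invertR inv (↭-trans (↭-sym eΔ) σ) p)
invertR inv σ (∀R {R} {T} {Γ} {w = w} {u} {y} {φ} (eR , eT , eΓ , eΔ) u∉ y∉ p)
  with heads σ eΔ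
invertR () σ (∀R _ _ _ _) | same _
... | apart _ σ₁ σ₂ =
  let ⊑Δ = ⊑*-∷ (w , Fa φ) (InvertibleR-⊑* inv σ₁)
  in
  rule₁ (∀R (eR , eT , eΓ , prefix-↭-∷ _ σ₂)
            (fresh-label R T (⊑*-refl {Γ}) ⊑Δ u∉) (fresh-var R T (⊑*-refl {Γ}) ⊑Δ y∉))
    (λ _ → refl) (invertR-under inv ((u , φ [ fvar y ]) ∷ []) σ₁ p)
invertR inv σ (ds d (eR , eT , eΓ , eΔ) p) =
  rule₁ (ds d (eR , eT , eΓ , ↭-refl)) (λ _ → refl) (invertR inv (↭-trans (↭-sym eΔ) σ) p)

lemma39 : (C : Mode) (R : List RelAtom) (T : List DomAtom) (Γ Δ : List LF)
    (w : Label) (φ ψ : Formula) →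
    (WF ⟨ R ∣ T ∣ (w , φ ∧̇ ψ) ∷ Γ ⊢ Δ ⟩ →
      HPInv C ⟨ R ∣ T ∣ (w , φ ∧̇ ψ) ∷ Γ ⊢ Δ ⟩ ⟨ R ∣ T ∣ (w , φ) ∷ (w , ψ) ∷ Γ ⊢ Δ ⟩)
    × (WF ⟨ R ∣ T ∣ Γ ⊢ (w , φ ∧̇ ψ) ∷ Δ ⟩ →
      HPInv C ⟨ R ∣ T ∣ Γ ⊢ (w , φ ∧̇ ψ) ∷ Δ ⟩ ⟨ R ∣ T ∣ Γ ⊢ (w , φ) ∷ Δ ⟩
      × HPInv C ⟨ R ∣ T ∣ Γ ⊢ (w , φ ∧̇ ψ) ∷ Δ ⟩ ⟨ R ∣ T ∣ Γ ⊢ (w , ψ) ∷ Δ ⟩)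
    × (WF ⟨ R ∣ T ∣ (w , φ ∨̇ ψ) ∷ Γ ⊢ Δ ⟩ →
      HPInv C ⟨ R ∣ T ∣ (w , φ ∨̇ ψ) ∷ Γ ⊢ Δ ⟩ ⟨ R ∣ T ∣ (w , φ) ∷ Γ ⊢ Δ ⟩
      × HPInv C ⟨ R ∣ T ∣ (w , φ ∨̇ ψ) ∷ Γ ⊢ Δ ⟩ ⟨ R ∣ T ∣ (w , ψ) ∷ Γ ⊢ Δ ⟩)
    × (WF ⟨ R ∣ T ∣ Γ ⊢ (w , φ ∨̇ ψ) ∷ Δ ⟩ →
      HPInv C ⟨ R ∣ T ∣ Γ ⊢ (w , φ ∨̇ ψ) ∷ Δ ⟩ ⟨ R ∣ T ∣ Γ ⊢ (w , φ) ∷ (w , ψ) ∷ Δ ⟩)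
lemma39 _ _ _ _ _ _ _ _ =
  (λ _ → invertL ∧L⁻ ↭-refl)
  , (λ _ → invertR ∧R⁻₁ ↭-refl , invertR ∧R⁻₂ ↭-refl)
  , (λ _ → invertL ∨L⁻₁ ↭-refl , invertL ∨L⁻₂ ↭-refl)
  , (λ _ → invertR ∨R⁻ ↭-refl)
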